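{- Let $\mathbb{A}=(L,\wedge,\vee,{}',\top,\bot)$ be a semi De Morgan algebra and let $\Box$ and $\vartriangleright$ be the unary operations on $L$ given by $\Box a=a''$ and $\vartriangleright a=a'$. Then, as maps on the canonical extension $L^\delta$ of the lattice reduct of $\mathbb{A}$, (1) $\Box^\pi=e^\pi\circ h^\delta$; (2) $\vartriangleright^\pi=e^\pi\circ{}^{*^\delta}\circ h^\delta$.
   Context: A semi De Morgan algebra is an algebra $(L,\wedge,\vee,{}',\top,\bot)$ with bounded distributive lattice reduct and $\bot'=\top$, $\top'=\bot$, $(a\vee b)'=a'\wedge b'$, $(a\wedge b)''=a''\wedge b''$, $a'=a'''$. Let $K=\{a'':a\in L\}$, $h:L\to K$ with $h(a)=a''$, $e:K\to L$ the inclusion, and let the kernel $\mathbb{K}=(K,\cap,\cup,{}^*,1,0)$ have $\alpha\cup\beta=h((e(\alpha)\vee e(\beta))'')$, $\alpha\cap\beta=h(e(\alpha)\wedge e(\beta))$, $1=h(\top)$, $0=h(\bot)$, $\alpha^*=h(e(\alpha)')$ (it is a De Morgan algebra). $L^\delta$ and $K^\delta$ are the canonical extensions (Gehrke–Jónsson) of the lattice reduct of $\mathbb{A}$ and of $\mathbb{K}$; for a map $f$ between such algebras, $f^\pi$ denotes its $\pi$-extension; ${}^{*^\delta}$ is the canonical extension of ${}^*$ on $K^\delta$, $e^\pi:K^\delta\to L^\delta$ the $\pi$-extension of $e$, and $h^\delta:L^\delta\to K^\delta$ the canonical extension of $h$ (its $\sigma$- and $\pi$-extensions coincide). -}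

module Defs where

open import Level using (Level; Lift; lift; lower) renaming (suc to lsuc; _⊔_ to _⊔ˡ_)
open import Data.Product using (Σ; ∃; _×_; _,_; proj₁; proj₂)
open import Data.List using (List; foldr)
open import Data.List.Relation.Unary.All using (All)
open import Relation.Binary.PropositionalEquality using (_≡_; refl)
open import Relation.Binary.Bundles using (Poset)
open import Relation.Unary using (Pred)

record SemiDeMorgan (a : Level) : Set (lsuc a) where
  infixr 7 _∧_
  infixr 6 _∨_
  field
    L       : Set a
    _∧_ _∨_ : L → L → L
    neg     : L → L
    ⊤ ⊥     : L
    ∧-assoc : ∀ x y z → (x ∧ y) ∧ z ≡ x ∧ (y ∧ z)
    ∨-assoc : ∀ x y z → (x ∨ y) ∨ z ≡ x ∨ (y ∨ z)
    ∧-comm  : ∀ x y → x ∧ y ≡ y ∧ x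
    ∨-comm  : ∀ x y → x ∨ y ≡ y ∨ x
    ∧-absorbs-∨ : ∀ x y → x ∧ (x ∨ y) ≡ x
    ∨-absorbs-∧ : ∀ x y → x ∨ (x ∧ y) ≡ x
    ∧-distrib-∨ : ∀ x y z → x ∧ (y ∨ z) ≡ (x ∧ y) ∨ (x ∧ z)
    ∧-identity : ∀ x → x ∧ ⊤ ≡ x
    ∨-identity : ∀ x → x ∨ ⊥ ≡ x
    neg-⊥ : neg ⊥ ≡ ⊤
    neg-⊤ : neg ⊤ ≡ ⊥
    neg-∨ : ∀ x y → neg (x ∨ y) ≡ neg x ∧ neg y
    neg²-∧ : ∀ x y → neg (neg (x ∧ y)) ≡ neg (neg x) ∧ neg (neg y)
    neg³  : ∀ x → neg x ≡ neg (neg (neg x))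

record LatticeData (a : Level) : Set (lsuc a) where
  field
    Carrier : Set a
    _≤_     : Carrier → Carrier → Set a
    _⊓_ _⊔_ : Carrier → Carrier → Carrier
    top bot : Carrier

record CompleteLattice (c ℓ ι : Level) : Set (lsuc (c ⊔ˡ ℓ ⊔ˡ ι)) where
  field
    poset : Poset c ℓ ℓ
  open Poset poset public
  field
    ⋀ : {I : Set ι} → (I → Carrier) → Carrier
    ⋁ : {I : Set ι} → (I → Carrier) → Carrier
    ⋀-lower    : ∀ {I : Set ι} (f : I → Carrier) i → ⋀ f ≤ f i
    ⋀-greatest : ∀ {I : Set ι} (f : I → Carrier) x → (∀ i → x ≤ f i) → x ≤ ⋀ f
    ⋁-upper    : ∀ {I : Set ι} (f : I → Carrier) i → f i ≤ ⋁ f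
    ⋁-least    : ∀ {I : Set ι} (f : I → Carrier) x → (∀ i → f i ≤ x) → ⋁ f ≤ x

module _ {a c ℓ : Level} (A : LatticeData a) (C : CompleteLattice c ℓ (lsuc a ⊔ˡ ℓ)) where
  private
    module A = LatticeData A
    module C = CompleteLattice C

  meetImg : (A.Carrier → C.Carrier) → Pred A.Carrier a → C.Carrier
  meetImg emb S = C.⋀ {I = Lift (lsuc a ⊔ˡ ℓ) (Σ A.Carrier S)} (λ i → emb (proj₁ (lower i)))

  joinImg : (A.Carrier → C.Carrier) → Pred A.Carrier a → C.Carrier
  joinImg emb T = C.⋁ {I = Lift (lsuc a ⊔ˡ ℓ) (Σ A.Carrier T)} (λ i → emb (proj₁ (lower i)))

  record IsCanonicalExtension (emb : A.Carrier → C.Carrier) : Set (lsuc a ⊔ˡ c ⊔ˡ ℓ) where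
    field
      mono     : ∀ x y → x A.≤ y → emb x C.≤ emb y
      reflects : ∀ x y → emb x C.≤ emb y → x A.≤ y
      ⊓-lb₁ : ∀ x y → emb (x A.⊓ y) C.≤ emb x
      ⊓-lb₂ : ∀ x y → emb (x A.⊓ y) C.≤ emb y
      ⊓-glb : ∀ x y z → z C.≤ emb x → z C.≤ emb y → z C.≤ emb (x A.⊓ y)
      ⊔-ub₁ : ∀ x y → emb x C.≤ emb (x A.⊔ y)
      ⊔-ub₂ : ∀ x y → emb y C.≤ emb (x A.⊔ y)
      ⊔-lub : ∀ x y z → emb x C.≤ z → emb y C.≤ z → emb (x A.⊔ y) C.≤ z
      top-greatest : ∀ z → z C.≤ emb A.top
      bot-least    : ∀ z → emb A.bot C.≤ z
      dense-⋁⋀ : ∀ u → u C.≈ C.⋁ {I = Σ (Pred A.Carrier a) (λ S → meetImg emb S C.≤ u)}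
                                  (λ i → meetImg emb (proj₁ i))
      dense-⋀⋁ : ∀ u → u C.≈ C.⋀ {I = Σ (Pred A.Carrier a) (λ T → u C.≤ joinImg emb T)}
                                  (λ i → joinImg emb (proj₁ i))
      compact : ∀ (S T : Pred A.Carrier a) → meetImg emb S C.≤ joinImg emb T →
                Σ (List A.Carrier) λ xs → Σ (List A.Carrier) λ ys →
                  All S xs × All T ys × (foldr A._⊓_ A.top xs A.≤ foldr A._⊔_ A.bot ys)

-- π-extension of an arbitrary map f : A → B (Gehrke–Jónsson):
--   f^π(u) = ⋀ { ⋁ { f(a) : x ≤ a ≤ y } : x closed, y open, x ≤ u ≤ y }
-- closed elements being meets ⋀e[S], open elements joins ⋁e[T].
module _ {a c ℓ : Level}
         (A : LatticeData a) (CA : CompleteLattice c ℓ (lsuc a ⊔ˡ ℓ))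
         (eA : LatticeData.Carrier A → CompleteLattice.Carrier CA)
         (B : LatticeData a) (CB : CompleteLattice c ℓ (lsuc a ⊔ˡ ℓ))
         (eB : LatticeData.Carrier B → CompleteLattice.Carrier CB) where
  private
    module A = LatticeData A
    module CA = CompleteLattice CA
    module CB = CompleteLattice CB

  πext : (A.Carrier → LatticeData.Carrier B) → CA.Carrier → CB.Carrier
  πext f u =
    CB.⋀ {I = Σ (Pred A.Carrier a) λ S → Σ (Pred A.Carrier a) λ T →
                 (meetImg A CA eA S CA.≤ u) × (u CA.≤ joinImg A CA eA T)}
      (λ i → CB.⋁ {I = Lift (lsuc a ⊔ˡ ℓ)
                        (Σ A.Carrier λ x → (meetImg A CA eA (proj₁ i) CA.≤ eA x)
                                          × (eA x CA.≤ joinImg A CA eA (proj₁ (proj₂ i))))}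
                   (λ j → eB (f (proj₁ (lower j)))))

module _ {a : Level} (𝔸 : SemiDeMorgan a) where
  open SemiDeMorgan 𝔸

  latL : LatticeData a
  latL = record { Carrier = L ; _≤_ = λ x y → x ∧ y ≡ x
                ; _⊓_ = _∧_ ; _⊔_ = _∨_ ; top = ⊤ ; bot = ⊥ }

  K : Set a
  K = Σ L λ x → ∃ λ b → x ≡ neg (neg b)

  h : L → K
  h b = neg (neg b) , b , refl

  e : K → L
  e = proj₁

  _∩_ _∪_ : K → K → K
  α ∩ β = h (e α ∧ e β)
  α ∪ β = h (neg (neg (e α ∨ e β)))

  star : K → K
  star α = h (neg (e α))

  1K 0K : K
  1K = h ⊤
  0K = h ⊥

  latK : LatticeData a
  latK = record { Carrier = K ; _≤_ = λ α β → e (α ∩ β) ≡ e α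
                ; _⊓_ = _∩_ ; _⊔_ = _∪_ ; top = 1K ; bot = 0K }

  □ ▷ : L → L
  □ x = neg (neg x)
  ▷ x = neg x

module Submission where

-- Both identities are instances of one composition principle for
-- π-extensions (Gehrke–Jónsson): if f : A → B is a lattice homomorphism
-- that moreover "lifts intervals" (every β with f s ≤ β ≤ f t is f x for
-- some x between s ⊓ t and s ⊔ t) and g : B → C is any map, then
--     (g ∘ f)^π = g^π ∘ f^π      on A^δ.
-- The inclusion (≤) pulls closed/open bounds of f^π(u) back along f, using
-- density and compactness; the reverse (≥) pushes closed/open bounds of u
-- forward and uses interval lifting to realise elements of B as values of f.
--
-- After the composition principle, h : L → K and
-- a ↦ (h a)* : L^∂ → K are shown to be interval-lifting homomorphisms.
-- Then (1) is the principle for □ = e ∘ h, and (2) follows from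
-- ▷ = e ∘ * ∘ h, applying it once on L^∂ (for e after a ↦ (h a)*) and once
-- on L (for * after h).

open import Defs
open import Level using (Level; _⊔_; Lift; lift; lower) renaming (suc to lsuc)
open import Data.Product using (_×_; Σ; _,_; proj₁; proj₂)
open import Data.List using (List; []; _∷_; foldr)
open import Data.List.Relation.Unary.All using (All; []; _∷_) renaming (map to All-map)
open import Relation.Binary.PropositionalEquality using (_≡_; refl; sym; trans; cong; cong₂; subst; subst₂)
open import Relation.Unary using (Pred)
import Relation.Binary.Properties.Poset as PosetProperties

module SemiDeMorganLaws {a : Level} (𝔸 : SemiDeMorgan a) where
  open SemiDeMorgan 𝔸

  _⊑_ : L → L → Set a
  x ⊑ y = x ∧ y ≡ x

  ∧-idem : ∀ x → x ∧ x ≡ x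
  ∧-idem x = trans (cong (x ∧_) (sym (∨-absorbs-∧ x x))) (∧-absorbs-∨ x (x ∧ x))

  ≡⇒⊑ : ∀ {x y} → x ≡ y → x ⊑ y
  ≡⇒⊑ {x} refl = ∧-idem x

  ⊑-trans : ∀ {x y z} → x ⊑ y → y ⊑ z → x ⊑ z
  ⊑-trans {x} {y} {z} p q =
    trans (cong (_∧ z) (sym p)) (trans (∧-assoc x y z) (trans (cong (x ∧_) q) p))

  ⊑-antisym : ∀ {x y} → x ⊑ y → y ⊑ x → x ≡ y
  ⊑-antisym {x} {y} p q = trans (sym p) (trans (∧-comm x y) q)

  ∧-lb₁ : ∀ x y → (x ∧ y) ⊑ x
  ∧-lb₁ x y = trans (∧-assoc x y x) (trans (cong (x ∧_) (∧-comm y x))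
                (trans (sym (∧-assoc x x y)) (cong (_∧ y) (∧-idem x))))

  ∧-lb₂ : ∀ x y → (x ∧ y) ⊑ y
  ∧-lb₂ x y = trans (∧-assoc x y y) (cong (x ∧_) (∧-idem y))

  ∧-glb : ∀ {x y z} → z ⊑ x → z ⊑ y → z ⊑ (x ∧ y)
  ∧-glb {x} {y} {z} p q = trans (sym (∧-assoc z x y)) (trans (cong (_∧ y) p) q)

  ∨-ub₁ : ∀ x y → x ⊑ (x ∨ y)
  ∨-ub₁ x y = ∧-absorbs-∨ x y

  ∨-ub₂ : ∀ x y → y ⊑ (x ∨ y)
  ∨-ub₂ x y = trans (cong (y ∧_) (∨-comm x y)) (∧-absorbs-∨ y x)

  ∨-lub : ∀ {x y z} → x ⊑ z → y ⊑ z → (x ∨ y) ⊑ z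
  ∨-lub {x} {y} {z} p q = trans (∧-comm (x ∨ y) z) (trans (∧-distrib-∨ z x y)
    (cong₂ _∨_ (trans (∧-comm z x) p) (trans (∧-comm z y) q)))

  ⊑⇒∨≡ : ∀ {x y} → x ⊑ y → x ∨ y ≡ y
  ⊑⇒∨≡ {x} {y} p = trans (cong (_∨ y) (sym p)) (trans (∨-comm (x ∧ y) y)
    (trans (cong (y ∨_) (∧-comm x y)) (∨-absorbs-∧ y x)))

  neg-antitone : ∀ {x y} → x ⊑ y → neg y ⊑ neg x
  neg-antitone {x} {y} p = trans (∧-comm (neg y) (neg x))
    (trans (sym (neg-∨ x y)) (cong neg (⊑⇒∨≡ p)))

  neg²-monotone : ∀ {x y} → x ⊑ y → neg (neg x) ⊑ neg (neg y)
  neg²-monotone p = neg-antitone (neg-antitone p)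

  neg⁴≡neg² : ∀ x → neg (neg (neg (neg x))) ≡ neg (neg x)
  neg⁴≡neg² x = sym (neg³ (neg x))

  neg⁵≡neg : ∀ x → neg (neg (neg (neg (neg x)))) ≡ neg x
  neg⁵≡neg x = trans (sym (neg³ (neg (neg x)))) (sym (neg³ x))

  neg²-∨ : ∀ x y → neg (neg (x ∨ y)) ≡ neg (neg (neg (neg x) ∨ neg (neg y)))
  neg²-∨ x y = cong neg (sym (trans (neg-∨ (neg (neg x)) (neg (neg y)))
    (trans (cong₂ _∧_ (sym (neg³ x)) (sym (neg³ y))) (sym (neg-∨ x y)))))

  neg-∧ : ∀ x y → neg (x ∧ y) ≡ neg (neg (neg x ∨ neg y))
  neg-∧ x y = trans (neg³ (x ∧ y))
    (cong neg (sym (trans (neg-∨ (neg x) (neg y)) (sym (neg²-∧ x y)))))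

  kernel-fixed : (α : K 𝔸) → neg (neg (e 𝔸 α)) ≡ e 𝔸 α
  kernel-fixed (.(neg (neg b)) , b , refl) = neg⁴≡neg² b

  _⊑K_ : K 𝔸 → K 𝔸 → Set a
  _⊑K_ = LatticeData._≤_ (latK 𝔸)

  ⊑K⇒⊑ : ∀ {α β} → α ⊑K β → e 𝔸 α ⊑ e 𝔸 β
  ⊑K⇒⊑ {α} {β} p = trans (sym (cong₂ _∧_ (kernel-fixed α) (kernel-fixed β)))
    (trans (sym (neg²-∧ (e 𝔸 α) (e 𝔸 β))) p)

  ⊑⇒⊑K : ∀ {α β} → e 𝔸 α ⊑ e 𝔸 β → α ⊑K β
  ⊑⇒⊑K {α} {β} p = trans (cong (λ z → neg (neg z)) p) (kernel-fixed α)

  ≡⇒⊑K : ∀ {α β} → e 𝔸 α ≡ e 𝔸 β → α ⊑K β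
  ≡⇒⊑K {α} {β} p = ⊑⇒⊑K {α} {β} (≡⇒⊑ p)

  ⊑K-antisym : ∀ {α β} → α ⊑K β → β ⊑K α → e 𝔸 α ≡ e 𝔸 β
  ⊑K-antisym {α} {β} p q = ⊑-antisym (⊑K⇒⊑ {α} {β} p) (⊑K⇒⊑ {β} {α} q)

module ClosedOpen {a c ℓ : Level} (A : LatticeData a) (C : CompleteLattice c ℓ (lsuc a ⊔ ℓ))
                  (emb : LatticeData.Carrier A → CompleteLattice.Carrier C)
                  (ce : IsCanonicalExtension A C emb) where
  private
    module A = LatticeData A
    module C = CompleteLattice C
  open IsCanonicalExtension ce

  ⋀e ⋁e : Pred A.Carrier a → C.Carrier
  ⋀e = meetImg A C emb
  ⋁e = joinImg A C emb

  ⋀e-lower : ∀ {S x} → S x → ⋀e S C.≤ emb x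
  ⋀e-lower {S} {x} x∈S = C.⋀-lower (λ i → emb (proj₁ (lower i))) (lift (x , x∈S))

  ⋁e-upper : ∀ {T x} → T x → emb x C.≤ ⋁e T
  ⋁e-upper {T} {x} x∈T = C.⋁-upper (λ i → emb (proj₁ (lower i))) (lift (x , x∈T))

  meetList joinList : List A.Carrier → A.Carrier
  meetList = foldr A._⊓_ A.top
  joinList = foldr A._⊔_ A.bot

  ≤-meetList : ∀ {z xs} → All (λ x → z C.≤ emb x) xs → z C.≤ emb (meetList xs)
  ≤-meetList {z} [] = top-greatest z
  ≤-meetList {z} {x ∷ xs} (p ∷ ps) = ⊓-glb x (meetList xs) z p (≤-meetList ps)

  joinList-≤ : ∀ {z xs} → All (λ x → emb x C.≤ z) xs → emb (joinList xs) C.≤ z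
  joinList-≤ {z} [] = bot-least z
  joinList-≤ {z} {x ∷ xs} (p ∷ ps) = ⊔-lub x (joinList xs) z p (joinList-≤ ps)

  -- The filter generated by S and the ideal generated by T, as predicates on A
  -- (they live in the universe of A, unlike comparisons in C).
  Filter Ideal : Pred A.Carrier a → Pred A.Carrier a
  Filter S x = Σ (List A.Carrier) λ xs → All S xs × (meetList xs A.≤ x)
  Ideal T x = Σ (List A.Carrier) λ ys → All T ys × (x A.≤ joinList ys)

  Filter⇒⋀e≤ : ∀ {S x} → Filter S x → ⋀e S C.≤ emb x
  Filter⇒⋀e≤ (xs , xs⊆S , meet≤x) = C.trans (≤-meetList (All-map ⋀e-lower xs⊆S)) (mono _ _ meet≤x)

  Ideal⇒≤⋁e : ∀ {T x} → Ideal T x → emb x C.≤ ⋁e T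
  Ideal⇒≤⋁e (ys , ys⊆T , x≤join) = C.trans (mono _ _ x≤join) (joinList-≤ (All-map ⋁e-upper ys⊆T))

  ⋀e≤⇒Filter : ∀ {S x} → ⋀e S C.≤ emb x → Filter S x
  ⋀e≤⇒Filter {S} {x} S≤x with compact S (_≡ x) (C.trans S≤x (⋁e-upper {_≡ x} refl))
  ... | xs , ys , xs⊆S , ys≡x , meet≤join =
    xs , xs⊆S , reflects _ _ (C.trans (mono _ _ meet≤join) (joinList-≤ (All-map (λ { refl → C.refl }) ys≡x)))

  ≤⋁e⇒Ideal : ∀ {T x} → emb x C.≤ ⋁e T → Ideal T x
  ≤⋁e⇒Ideal {T} {x} x≤T with compact (_≡ x) T (C.trans (⋀e-lower {_≡ x} refl) x≤T)
  ... | xs , ys , xs≡x , ys⊆T , meet≤join =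
    ys , ys⊆T , reflects _ _ (C.trans (≤-meetList (All-map (λ { refl → C.refl }) xs≡x)) (mono _ _ meet≤join))

  interpolate : ∀ {S T} → ⋀e S C.≤ ⋁e T → Σ A.Carrier λ x → (⋀e S C.≤ emb x) × (emb x C.≤ ⋁e T)
  interpolate {S} {T} S≤T with compact S T S≤T
  ... | xs , ys , xs⊆S , ys⊆T , meet≤join =
    meetList xs , ≤-meetList (All-map ⋀e-lower xs⊆S) ,
    C.trans (mono _ _ meet≤join) (joinList-≤ (All-map ⋁e-upper ys⊆T))

module PiExtension {a c ℓ : Level}
         (A : LatticeData a) (CA : CompleteLattice c ℓ (lsuc a ⊔ ℓ))
         (eA : LatticeData.Carrier A → CompleteLattice.Carrier CA)
         (B : LatticeData a) (CB : CompleteLattice c ℓ (lsuc a ⊔ ℓ))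
         (eB : LatticeData.Carrier B → CompleteLattice.Carrier CB) where
  private
    module A = LatticeData A
    module B = LatticeData B
    module CA = CompleteLattice CA
    module CB = CompleteLattice CB

  ⋀e ⋁e : Pred A.Carrier a → CA.Carrier
  ⋀e = meetImg A CA eA
  ⋁e = joinImg A CA eA

  π : (A.Carrier → B.Carrier) → CA.Carrier → CB.Carrier
  π = πext A CA eA B CB eB

  ⋁interval : (A.Carrier → B.Carrier) → Pred A.Carrier a → Pred A.Carrier a → CB.Carrier
  ⋁interval f S T = CB.⋁ {I = Lift (lsuc a ⊔ ℓ) (Σ A.Carrier λ x → (⋀e S CA.≤ eA x) × (eA x CA.≤ ⋁e T))}
                         (λ j → eB (f (proj₁ (lower j))))

  π≤⋁interval : ∀ f u S T → ⋀e S CA.≤ u → u CA.≤ ⋁e T → π f u CB.≤ ⋁interval f S T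
  π≤⋁interval f u S T S≤u u≤T = CB.⋀-lower _ (S , T , S≤u , u≤T)

  ≤π : ∀ f u z → (∀ S T → ⋀e S CA.≤ u → u CA.≤ ⋁e T → z CB.≤ ⋁interval f S T) → z CB.≤ π f u
  ≤π f u z below = CB.⋀-greatest _ z (λ { (S , T , S≤u , u≤T) → below S T S≤u u≤T })

  ≤⋁interval : ∀ f S T x → ⋀e S CA.≤ eA x → eA x CA.≤ ⋁e T → eB (f x) CB.≤ ⋁interval f S T
  ≤⋁interval f S T x S≤x x≤T = CB.⋁-upper (λ j → eB (f (proj₁ (lower j)))) (lift (x , S≤x , x≤T))

  ⋁interval≤ : ∀ f S T z → (∀ x → ⋀e S CA.≤ eA x → eA x CA.≤ ⋁e T → eB (f x) CB.≤ z) →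
               ⋁interval f S T CB.≤ z
  ⋁interval≤ f S T z above = CB.⋁-least _ z (λ { (lift (x , S≤x , x≤T)) → above x S≤x x≤T })

  π-cong : ∀ f {u u′} → u CA.≈ u′ → π f u CB.≈ π f u′
  π-cong f u≈u′ = CB.antisym (mono u≈u′) (mono (CA.Eq.sym u≈u′))
    where
      mono : ∀ {u u′} → u CA.≈ u′ → π f u CB.≤ π f u′
      mono {u} {u′} u≈u′ = ≤π f u′ _ (λ S T S≤u′ u′≤T →
        π≤⋁interval f u S T (CA.trans S≤u′ (CA.reflexive (CA.Eq.sym u≈u′))) (CA.trans (CA.reflexive u≈u′) u′≤T))

  π-pointwise : ∀ f g → (∀ x → f x ≡ g x) → ∀ u → π f u CB.≈ π g u
  π-pointwise f g f≡g u = CB.antisym (below f g f≡g) (below g f (λ x → sym (f≡g x)))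
    where
      below : ∀ f g → (∀ x → f x ≡ g x) → π f u CB.≤ π g u
      below f g f≡g = ≤π g u _ (λ S T S≤u u≤T → CB.trans (π≤⋁interval f u S T S≤u u≤T)
        (⋁interval≤ f S T _ (λ x S≤x x≤T →
          subst (λ w → eB w CB.≤ ⋁interval g S T) (sym (f≡g x)) (≤⋁interval g S T x S≤x x≤T))))

dualLattice : ∀ {a} → LatticeData a → LatticeData a
dualLattice A = record { Carrier = A.Carrier ; _≤_ = λ x y → y A.≤ x
                       ; _⊓_ = A._⊔_ ; _⊔_ = A._⊓_ ; top = A.bot ; bot = A.top }
  where module A = LatticeData A

dualComplete : ∀ {c ℓ ι} → CompleteLattice c ℓ ι → CompleteLattice c ℓ ι
dualComplete C = record { poset = PosetProperties.≥-poset poset ; ⋀ = ⋁ ; ⋁ = ⋀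
                        ; ⋀-lower = ⋁-upper ; ⋀-greatest = ⋁-least
                        ; ⋁-upper = ⋀-lower ; ⋁-least = ⋀-greatest }
  where open CompleteLattice C

dualCanonical : ∀ {a c ℓ} {A : LatticeData a} {C : CompleteLattice c ℓ (lsuc a ⊔ ℓ)}
                  {emb : LatticeData.Carrier A → CompleteLattice.Carrier C} →
                IsCanonicalExtension A C emb → IsCanonicalExtension (dualLattice A) (dualComplete C) emb
dualCanonical ce = record
  { mono = λ x y p → mono y x p
  ; reflects = λ x y p → reflects y x p
  ; ⊓-lb₁ = ⊔-ub₁ ; ⊓-lb₂ = ⊔-ub₂ ; ⊓-glb = ⊔-lub
  ; ⊔-ub₁ = ⊓-lb₁ ; ⊔-ub₂ = ⊓-lb₂ ; ⊔-lub = ⊓-glb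
  ; top-greatest = bot-least ; bot-least = top-greatest
  ; dense-⋁⋀ = dense-⋀⋁ ; dense-⋀⋁ = dense-⋁⋀
  ; compact = λ S T T≤S → let (ys , xs , ys⊆T , xs⊆S , le) = compact T S T≤S in xs , ys , xs⊆S , ys⊆T , le
  }
  where open IsCanonicalExtension ce

-- The π-extension of f : A → B does not change when the order of the
-- domain is reversed: the intervals [⋀e S, ⋁e T] just swap their ends.
π-dual-domain : ∀ {a c ℓ}
  (A : LatticeData a) (CA : CompleteLattice c ℓ (lsuc a ⊔ ℓ))
  (eA : LatticeData.Carrier A → CompleteLattice.Carrier CA)
  (B : LatticeData a) (CB : CompleteLattice c ℓ (lsuc a ⊔ ℓ))
  (eB : LatticeData.Carrier B → CompleteLattice.Carrier CB) →
  ∀ f u → CompleteLattice._≈_ CB (PiExtension.π A CA eA B CB eB f u)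
                                 (PiExtension.π (dualLattice A) (dualComplete CA) eA B CB eB f u)
π-dual-domain A CA eA B CB eB f u = CB.antisym
    (Q.≤π f u _ (λ S T S≤u u≤T → CB.trans (P.π≤⋁interval f u T S u≤T S≤u)
       (P.⋁interval≤ f T S _ (λ x T≤x x≤S → Q.≤⋁interval f S T x x≤S T≤x))))
    (P.≤π f u _ (λ S T S≤u u≤T → CB.trans (Q.π≤⋁interval f u T S u≤T S≤u)
       (Q.⋁interval≤ f T S _ (λ x T≤x x≤S → P.≤⋁interval f S T x x≤S T≤x))))
  where
    module CB = CompleteLattice CB
    module P = PiExtension A CA eA B CB eB
    module Q = PiExtension (dualLattice A) (dualComplete CA) eA B CB eB

-- The notion is self-dual, so it applies to the order-reversing
-- map a ↦ (h a)* viewed on L^∂.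
module _ {a : Level} (A B : LatticeData a) where
  private
    module A = LatticeData A
    module B = LatticeData B

  record IsLiftingHomomorphism (f : A.Carrier → B.Carrier) : Set a where
    field
      monotone       : ∀ x y → x A.≤ y → f x B.≤ f y
      preserves-⊓    : ∀ x y → (f x B.⊓ f y) B.≤ f (x A.⊓ y)
      preserves-⊔    : ∀ x y → f (x A.⊔ y) B.≤ (f x B.⊔ f y)
      preserves-top  : B.top B.≤ f A.top
      preserves-bot  : f A.bot B.≤ B.bot
      lifts-interval : ∀ s t β → f s B.≤ β → β B.≤ f t →
                       Σ A.Carrier λ x → ((s A.⊓ t) A.≤ x) × (x A.≤ (s A.⊔ t)) × (f x B.≤ β) × (β B.≤ f x)

module Composition {a c ℓ : Level}
  (A : LatticeData a) (Aδ : CompleteLattice c ℓ (lsuc a ⊔ ℓ))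
  (eA : LatticeData.Carrier A → CompleteLattice.Carrier Aδ) (ceA : IsCanonicalExtension A Aδ eA)
  (B : LatticeData a) (Bδ : CompleteLattice c ℓ (lsuc a ⊔ ℓ))
  (eB : LatticeData.Carrier B → CompleteLattice.Carrier Bδ) (ceB : IsCanonicalExtension B Bδ eB)
  (f : LatticeData.Carrier A → LatticeData.Carrier B) (isHom : IsLiftingHomomorphism A B f) where
  private
    module A = LatticeData A
    module B = LatticeData B
    module Aδ = CompleteLattice Aδ
    module Bδ = CompleteLattice Bδ
    module iA = IsCanonicalExtension ceA
    module iB = IsCanonicalExtension ceB
    module OA = ClosedOpen A Aδ eA ceA
    module OB = ClosedOpen B Bδ eB ceB
    module Pf = PiExtension A Aδ eA B Bδ eB
    open IsLiftingHomomorphism isHom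

  fπ : Aδ.Carrier → Bδ.Carrier
  fπ = Pf.π f

  B-refl : ∀ β → β B.≤ β
  B-refl β = iB.reflects β β Bδ.refl

  f-mono : ∀ {x y} → eA x Aδ.≤ eA y → eB (f x) Bδ.≤ eB (f y)
  f-mono {x} {y} x≤y = iB.mono (f x) (f y) (monotone x y (iA.reflects x y x≤y))

  ≤-f-meetList : ∀ {z xs} → All (λ x → z Bδ.≤ eB (f x)) xs → z Bδ.≤ eB (f (OA.meetList xs))
  ≤-f-meetList {z} [] = Bδ.trans (iB.top-greatest z) (iB.mono _ _ preserves-top)
  ≤-f-meetList {z} {x ∷ xs} (p ∷ ps) =
    Bδ.trans (iB.⊓-glb (f x) (f (OA.meetList xs)) z p (≤-f-meetList ps)) (iB.mono _ _ (preserves-⊓ x (OA.meetList xs)))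

  f-joinList-≤ : ∀ {z xs} → All (λ x → eB (f x) Bδ.≤ z) xs → eB (f (OA.joinList xs)) Bδ.≤ z
  f-joinList-≤ {z} [] = Bδ.trans (iB.mono _ _ preserves-bot) (iB.bot-least z)
  f-joinList-≤ {z} {x ∷ xs} (p ∷ ps) =
    Bδ.trans (iB.mono _ _ (preserves-⊔ x (OA.joinList xs))) (iB.⊔-lub (f x) (f (OA.joinList xs)) z p (f-joinList-≤ ps))

  meet-witness : ∀ {p} (X : A.Carrier → Set p) → (∀ {s t} → X s → X t → X (s A.⊓ t)) → ∀ {x₀} → X x₀ →
    ∀ {αs} → All (λ α → Σ A.Carrier λ s → X s × (eB (f s) Bδ.≤ eB α)) αs →
    Σ A.Carrier λ s → X s × (eB (f s) Bδ.≤ eB (OB.meetList αs))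
  meet-witness X ⊓-closed {x₀} x₀∈X [] = x₀ , x₀∈X , iB.top-greatest _
  meet-witness X ⊓-closed x₀∈X {α ∷ αs} ((s₁ , s₁∈X , fs₁≤α) ∷ rest)
    with meet-witness X ⊓-closed x₀∈X rest
  ... | s₂ , s₂∈X , fs₂≤αs = s₁ A.⊓ s₂ , ⊓-closed s₁∈X s₂∈X ,
    iB.⊓-glb α (OB.meetList αs) _ (Bδ.trans (f-mono (iA.⊓-lb₁ s₁ s₂)) fs₁≤α)
                                  (Bδ.trans (f-mono (iA.⊓-lb₂ s₁ s₂)) fs₂≤αs)

  join-witness : ∀ {p} (X : A.Carrier → Set p) → (∀ {s t} → X s → X t → X (s A.⊔ t)) → ∀ {x₀} → X x₀ →
    ∀ {αs} → All (λ α → Σ A.Carrier λ t → X t × (eB α Bδ.≤ eB (f t))) αs →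
    Σ A.Carrier λ t → X t × (eB (OB.joinList αs) Bδ.≤ eB (f t))
  join-witness X ⊔-closed {x₀} x₀∈X [] = x₀ , x₀∈X , iB.bot-least _
  join-witness X ⊔-closed x₀∈X {α ∷ αs} ((t₁ , t₁∈X , α≤ft₁) ∷ rest)
    with join-witness X ⊔-closed x₀∈X rest
  ... | t₂ , t₂∈X , αs≤ft₂ = t₁ A.⊔ t₂ , ⊔-closed t₁∈X t₂∈X ,
    iB.⊔-lub α (OB.joinList αs) _ (Bδ.trans α≤ft₁ (f-mono (iA.⊔-ub₁ t₁ t₂)))
                                  (Bδ.trans αs≤ft₂ (f-mono (iA.⊔-ub₂ t₁ t₂)))

  fπ-above : ∀ u z S₀ → OA.⋀e S₀ Aδ.≤ u →
             (∀ x → OA.⋀e S₀ Aδ.≤ eA x → z Bδ.≤ eB (f x)) → z Bδ.≤ fπ u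
  fπ-above u z S₀ S₀≤u below-f = Pf.≤π f u z λ S T S≤u u≤T →
    let (x₀ , S₀≤x₀ , x₀≤T) = OA.interpolate (Aδ.trans S₀≤u u≤T)
        (y₀ , S≤y₀ , y₀≤T) = OA.interpolate (Aδ.trans S≤u u≤T)
    in Bδ.trans (below-f x₀ S₀≤x₀) (Bδ.trans (f-mono (iA.⊔-ub₁ x₀ y₀))
         (Pf.≤⋁interval f S T (x₀ A.⊔ y₀) (Aδ.trans S≤y₀ (iA.⊔-ub₂ x₀ y₀))
                                          (iA.⊔-lub x₀ y₀ _ x₀≤T y₀≤T)))

  fπ-below : ∀ u z S T → OA.⋀e S Aδ.≤ u → u Aδ.≤ OA.⋁e T →
             (∀ x → OA.⋀e S Aδ.≤ eA x → eA x Aδ.≤ OA.⋁e T → eB (f x) Bδ.≤ z) → fπ u Bδ.≤ z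
  fπ-below u z S T S≤u u≤T above-f = Bδ.trans (Pf.π≤⋁interval f u S T S≤u u≤T) (Pf.⋁interval≤ f S T z above-f)

  f⁻¹Filter f⁻¹Ideal : Pred B.Carrier a → Pred A.Carrier a
  f⁻¹Filter P x = OB.Filter P (f x)
  f⁻¹Ideal Q x = OB.Ideal Q (f x)

  f-above-⋀e : ∀ {P x} → OA.⋀e (f⁻¹Filter P) Aδ.≤ eA x → OB.⋀e P Bδ.≤ eB (f x)
  f-above-⋀e P≤x with OA.⋀e≤⇒Filter P≤x
  ... | xs , xs⊆ , meet≤x = Bδ.trans (≤-f-meetList (All-map OB.Filter⇒⋀e≤ xs⊆)) (f-mono (iA.mono _ _ meet≤x))

  f-below-⋁e : ∀ {Q x} → eA x Aδ.≤ OA.⋁e (f⁻¹Ideal Q) → eB (f x) Bδ.≤ OB.⋁e Q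
  f-below-⋁e x≤Q with OA.≤⋁e⇒Ideal x≤Q
  ... | ys , ys⊆ , x≤join = Bδ.trans (f-mono (iA.mono _ _ x≤join)) (f-joinList-≤ (All-map OB.Ideal⇒≤⋁e ys⊆))

  -- If f^π(u) ≤ ⋁e Q then every closed element below u lies below ⋁e (f⁻¹Ideal Q):
  -- compactness yields s ≥ ⋀e S₀ with f s ≤ ⋁e Q.
  ⋀e-below-f⁻¹Ideal : ∀ {u Q S₀} → fπ u Bδ.≤ OB.⋁e Q → OA.⋀e S₀ Aδ.≤ u →
                      OA.⋀e S₀ Aδ.≤ OA.⋁e (f⁻¹Ideal Q)
  ⋀e-below-f⁻¹Ideal {u} {Q} {S₀} fπu≤Q S₀≤u with iB.compact image Q (Bδ.trans image≤fπu fπu≤Q)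
    where
      image : Pred B.Carrier a
      image β = Σ A.Carrier λ s → OA.Filter S₀ s × (f s B.≤ β)
      image≤fπu : OB.⋀e image Bδ.≤ fπ u
      image≤fπu = fπ-above u _ S₀ S₀≤u (λ x S₀≤x → OB.⋀e-lower (x , OA.⋀e≤⇒Filter S₀≤x , B-refl (f x)))
  ... | αs , βs , αs⊆image , βs⊆Q , meet≤join
    with meet-witness (λ s → OA.⋀e S₀ Aδ.≤ eA s) (iA.⊓-glb _ _ _) (iA.top-greatest _)
           (All-map (λ { (s , s∈F , fs≤α) → s , OA.Filter⇒⋀e≤ s∈F , iB.mono _ _ fs≤α }) αs⊆image)
  ... | s , S₀≤s , fs≤meet = Aδ.trans S₀≤s (OA.⋁e-upper (OB.≤⋁e⇒Ideal
          (Bδ.trans fs≤meet (Bδ.trans (iB.mono _ _ meet≤join) (OB.joinList-≤ (All-map OB.⋁e-upper βs⊆Q))))))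

  ⋁e-above-f⁻¹Filter : ∀ {u P T₀} → OB.⋀e P Bδ.≤ fπ u → u Aδ.≤ OA.⋁e T₀ →
                       OA.⋀e (f⁻¹Filter P) Aδ.≤ OA.⋁e T₀
  ⋁e-above-f⁻¹Filter {u} {P} {T₀} P≤fπu u≤T₀ with iB.compact P image (Bδ.trans P≤fπu fπu≤image)
    where
      image : Pred B.Carrier a
      image β = Σ A.Carrier λ t → OA.Ideal T₀ t × (β B.≤ f t)
      fπu≤image : fπ u Bδ.≤ OB.⋁e image
      fπu≤image = fπ-below u _ (_≡ A.bot) T₀ (Aδ.trans (OA.⋀e-lower {_≡ A.bot} refl) (iA.bot-least u)) u≤T₀
                    (λ x _ x≤T₀ → OB.⋁e-upper (x , OA.≤⋁e⇒Ideal x≤T₀ , B-refl (f x)))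
  ... | αs , βs , αs⊆P , βs⊆image , meet≤join
    with join-witness (λ t → eA t Aδ.≤ OA.⋁e T₀) (iA.⊔-lub _ _ _) (iA.bot-least _)
           (All-map (λ { (t , t∈I , β≤ft) → t , OA.Ideal⇒≤⋁e t∈I , iB.mono _ _ β≤ft }) βs⊆image)
  ... | t , t≤T₀ , join≤ft = Aδ.trans
          (OA.⋀e-lower (αs , αs⊆P , iB.reflects _ _ (Bδ.trans (iB.mono _ _ meet≤join) join≤ft))) t≤T₀

  fπ≤⋁e⇒ : ∀ {u Q} → fπ u Bδ.≤ OB.⋁e Q → u Aδ.≤ OA.⋁e (f⁻¹Ideal Q)
  fπ≤⋁e⇒ {u} fπu≤Q = Aδ.trans (Aδ.reflexive (iA.dense-⋁⋀ u))
    (Aδ.⋁-least _ _ (λ i → ⋀e-below-f⁻¹Ideal fπu≤Q (proj₂ i)))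

  ⋀e≤fπ⇒ : ∀ {u P} → OB.⋀e P Bδ.≤ fπ u → OA.⋀e (f⁻¹Filter P) Aδ.≤ u
  ⋀e≤fπ⇒ {u} P≤fπu = Aδ.trans (Aδ.⋀-greatest _ _ (λ i → ⋁e-above-f⁻¹Filter P≤fπu (proj₂ i)))
    (Aδ.reflexive (Aδ.Eq.sym (iA.dense-⋀⋁ u)))

  -- g is arbitrary, except that it must not distinguish mutually below elements of B.
  module _ (C : LatticeData a) (Cδ : CompleteLattice c ℓ (lsuc a ⊔ ℓ))
           (eC : LatticeData.Carrier C → CompleteLattice.Carrier Cδ)
           (g : B.Carrier → LatticeData.Carrier C)
           (g-resp : ∀ α β → α B.≤ β → β B.≤ α → g α ≡ g β) where
    private
      module Cδ = CompleteLattice Cδ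
      module Pg = PiExtension B Bδ eB C Cδ eC
      module Pgf = PiExtension A Aδ eA C Cδ eC

      g∘f : A.Carrier → LatticeData.Carrier C
      g∘f x = g (f x)

    -- (≤): a bound ⋀e P ≤ f^π(u) ≤ ⋁e Q pulls back to ⋀e (f⁻¹Filter P) ≤ u ≤ ⋁e (f⁻¹Ideal Q),
    -- and f maps that interval of A into [⋀e P, ⋁e Q].
    π-∘-≤ : ∀ u → Pgf.π g∘f u Cδ.≤ Pg.π g (fπ u)
    π-∘-≤ u = Pg.≤π g (fπ u) _ λ P Q P≤fπu fπu≤Q →
      Cδ.trans (Pgf.π≤⋁interval g∘f u (f⁻¹Filter P) (f⁻¹Ideal Q) (⋀e≤fπ⇒ P≤fπu) (fπ≤⋁e⇒ fπu≤Q))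
               (Pgf.⋁interval≤ g∘f _ _ _ (λ x P≤x x≤Q →
                  Pg.≤⋁interval g P Q (f x) (f-above-⋀e P≤x) (f-below-⋁e x≤Q)))

    -- (≥): for ⋀e S ≤ u ≤ ⋁e T, every β ∈ B between the closed ⋀e R↑ and the open
    -- ⋁e R↓ enclosing f^π(u) is f x for some x in [⋀e S, ⋁e T].
    module Pushforward (u : Aδ.Carrier) (S T : Pred A.Carrier a)
                       (S≤u : OA.⋀e S Aδ.≤ u) (u≤T : u Aδ.≤ OA.⋁e T) where
      InInterval : A.Carrier → Set ℓ
      InInterval x = (OA.⋀e S Aδ.≤ eA x) × (eA x Aδ.≤ OA.⋁e T)

      x₀ : A.Carrier
      x₀ = proj₁ (OA.interpolate (Aδ.trans S≤u u≤T))

      x₀-inside : InInterval x₀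
      x₀-inside = proj₂ (OA.interpolate (Aδ.trans S≤u u≤T))

      inside : ∀ {x} → OA.Filter S x → OA.Ideal T x → InInterval x
      inside x∈F x∈I = OA.Filter⇒⋀e≤ x∈F , OA.Ideal⇒≤⋁e x∈I

      R↑ R↓ : Pred B.Carrier a
      R↑ β = Σ A.Carrier λ x → OA.Filter S x × OA.Ideal T x × (f x B.≤ β)
      R↓ β = Σ A.Carrier λ x → OA.Filter S x × OA.Ideal T x × (β B.≤ f x)

      R↑≤fπu : OB.⋀e R↑ Bδ.≤ fπ u
      R↑≤fπu = fπ-above u _ S S≤u (λ x S≤x → OB.⋀e-lower
        (x A.⊓ x₀ , OA.⋀e≤⇒Filter (iA.⊓-glb x x₀ _ S≤x (proj₁ x₀-inside)) ,
         OA.≤⋁e⇒Ideal (Aδ.trans (iA.⊓-lb₂ x x₀) (proj₂ x₀-inside)) ,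
         monotone _ _ (iA.reflects _ _ (iA.⊓-lb₁ x x₀))))

      fπu≤R↓ : fπ u Bδ.≤ OB.⋁e R↓
      fπu≤R↓ = fπ-below u _ S T S≤u u≤T (λ x S≤x x≤T →
        OB.⋁e-upper (x , OA.⋀e≤⇒Filter S≤x , OA.≤⋁e⇒Ideal x≤T , B-refl (f x)))

      lower-witness : ∀ {β} → OB.⋀e R↑ Bδ.≤ eB β → Σ A.Carrier λ s → InInterval s × (f s B.≤ β)
      lower-witness R↑≤β with OB.⋀e≤⇒Filter R↑≤β
      ... | αs , αs⊆R↑ , meet≤β
        with meet-witness InInterval
               (λ (S≤s , s≤T) (S≤t , _) → iA.⊓-glb _ _ _ S≤s S≤t , Aδ.trans (iA.⊓-lb₁ _ _) s≤T) x₀-inside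
               (All-map (λ { (x , x∈F , x∈I , fx≤α) → x , inside x∈F x∈I , iB.mono _ _ fx≤α }) αs⊆R↑)
      ... | s , s-inside , fs≤meet = s , s-inside , iB.reflects _ _ (Bδ.trans fs≤meet (iB.mono _ _ meet≤β))

      upper-witness : ∀ {β} → eB β Bδ.≤ OB.⋁e R↓ → Σ A.Carrier λ t → InInterval t × (β B.≤ f t)
      upper-witness β≤R↓ with OB.≤⋁e⇒Ideal β≤R↓
      ... | αs , αs⊆R↓ , β≤join
        with join-witness InInterval
               (λ (S≤s , s≤T) (_ , t≤T) → Aδ.trans S≤s (iA.⊔-ub₁ _ _) , iA.⊔-lub _ _ _ s≤T t≤T) x₀-inside
               (All-map (λ { (x , x∈F , x∈I , α≤fx) → x , inside x∈F x∈I , iB.mono _ _ α≤fx }) αs⊆R↓)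
      ... | t , t-inside , join≤ft = t , t-inside , iB.reflects _ _ (Bδ.trans (iB.mono _ _ β≤join) join≤ft)

      realise : ∀ β → OB.⋀e R↑ Bδ.≤ eB β → eB β Bδ.≤ OB.⋁e R↓ → eC (g β) Cδ.≤ Pgf.⋁interval g∘f S T
      realise β R↑≤β β≤R↓ with lower-witness R↑≤β | upper-witness β≤R↓
      ... | s , (S≤s , s≤T) , fs≤β | t , (S≤t , t≤T) , β≤ft
        with lifts-interval s t β fs≤β β≤ft
      ... | x , s⊓t≤x , x≤s⊔t , fx≤β , β≤fx =
        subst (λ w → eC w Cδ.≤ Pgf.⋁interval g∘f S T) (g-resp (f x) β fx≤β β≤fx)
          (Pgf.≤⋁interval g∘f S T x (Aδ.trans (iA.⊓-glb s t _ S≤s S≤t) (iA.mono _ _ s⊓t≤x))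
                                   (Aδ.trans (iA.mono _ _ x≤s⊔t) (iA.⊔-lub s t _ s≤T t≤T)))

      g^π∘f^π≤ : Pg.π g (fπ u) Cδ.≤ Pgf.⋁interval g∘f S T
      g^π∘f^π≤ = Cδ.trans (Pg.π≤⋁interval g (fπ u) R↑ R↓ R↑≤fπu fπu≤R↓)
                          (Pg.⋁interval≤ g R↑ R↓ _ realise)

    π-∘-≥ : ∀ u → Pg.π g (fπ u) Cδ.≤ Pgf.π g∘f u
    π-∘-≥ u = Pgf.≤π g∘f u _ (λ S T S≤u u≤T → Pushforward.g^π∘f^π≤ u S T S≤u u≤T)

    π-∘ : ∀ u → Pgf.π g∘f u Cδ.≈ Pg.π g (fπ u)
    π-∘ u = Cδ.antisym (π-∘-≤ u) (π-∘-≥ u)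

module KernelMaps {a : Level} (𝔸 : SemiDeMorgan a) where
  open SemiDeMorgan 𝔸
  open SemiDeMorganLaws 𝔸

  -- Interval lifting for h: if s″ ≤ β ≤ t″ then x = s ∨ (β ∧ t) has x″ = β.
  h-lifts : ∀ s t β → h 𝔸 s ⊑K β → β ⊑K h 𝔸 t → neg (neg (s ∨ (e 𝔸 β ∧ t))) ≡ e 𝔸 β
  h-lifts s t β s≤β β≤t = ⊑-antisym x″≤b b≤x″
    where
      b : L
      b = e 𝔸 β
      s″≤b : neg (neg s) ⊑ b
      s″≤b = ⊑K⇒⊑ {h 𝔸 s} {β} s≤β
      b≤t″ : b ⊑ neg (neg t)
      b≤t″ = ⊑K⇒⊑ {β} {h 𝔸 t} β≤t
      -- (s ∨ b)″ = (s″ ∨ b″)″ = b″ = b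
      [s∨b]″≡b : neg (neg (s ∨ b)) ≡ b
      [s∨b]″≡b = trans (neg²-∨ s b) (trans (cong (λ z → neg (neg (neg (neg s) ∨ z))) (kernel-fixed β))
                   (trans (cong (λ z → neg (neg z)) (⊑⇒∨≡ s″≤b)) (kernel-fixed β)))
      x″≤b : neg (neg (s ∨ (b ∧ t))) ⊑ b
      x″≤b = ⊑-trans (neg²-monotone (∨-lub (∨-ub₁ s b) (⊑-trans (∧-lb₁ b t) (∨-ub₂ s b))))
                     (≡⇒⊑ [s∨b]″≡b)
      -- b = b ∧ t″ = (b ∧ t)″ ≤ (s ∨ (b ∧ t))″
      b≤x″ : b ⊑ neg (neg (s ∨ (b ∧ t)))
      b≤x″ = ⊑-trans (≡⇒⊑ (trans (sym b≤t″)
                        (trans (cong (_∧ neg (neg t)) (sym (kernel-fixed β))) (sym (neg²-∧ b t)))))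
                     (neg²-monotone (∨-ub₂ s (b ∧ t)))

  h-isLiftingHomomorphism : IsLiftingHomomorphism (latL 𝔸) (latK 𝔸) (h 𝔸)
  h-isLiftingHomomorphism = record
    { monotone = λ x y x≤y → ⊑⇒⊑K {h 𝔸 x} {h 𝔸 y} (neg²-monotone x≤y)
    ; preserves-⊓ = λ x y → ≡⇒⊑K {_∩_ 𝔸 (h 𝔸 x) (h 𝔸 y)} {h 𝔸 (x ∧ y)}
        (trans (neg²-∧ _ _) (trans (cong₂ _∧_ (neg⁴≡neg² x) (neg⁴≡neg² y)) (sym (neg²-∧ x y))))
    ; preserves-⊔ = λ x y → ≡⇒⊑K {h 𝔸 (x ∨ y)} {_∪_ 𝔸 (h 𝔸 x) (h 𝔸 y)}
        (trans (neg²-∨ x y) (sym (neg⁴≡neg² _)))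
    ; preserves-top = ≡⇒⊑K {1K 𝔸} {h 𝔸 ⊤} refl
    ; preserves-bot = ≡⇒⊑K {h 𝔸 ⊥} {0K 𝔸} refl
    ; lifts-interval = λ s t β s≤β β≤t →
        s ∨ (e 𝔸 β ∧ t) , ⊑-trans (∧-lb₁ s t) (∨-ub₁ s _) ,
        ∨-lub (∨-ub₁ s t) (⊑-trans (∧-lb₂ (e 𝔸 β) t) (∨-ub₂ s t)) ,
        ≡⇒⊑K {h 𝔸 (s ∨ (e 𝔸 β ∧ t))} {β} (h-lifts s t β s≤β β≤t) ,
        ≡⇒⊑K {β} {h 𝔸 (s ∨ (e 𝔸 β ∧ t))} (sym (h-lifts s t β s≤β β≤t))
    }

  ▷K : L → K 𝔸
  ▷K x = star 𝔸 (h 𝔸 x)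

  e-▷K : ∀ x → e 𝔸 (▷K x) ≡ neg x
  e-▷K = neg⁵≡neg

  -- Interval lifting for ▷K on L^∂: if t′ ≥ β ≥ s′ in K then x = s ∧ (β′ ∨ t) has x′ = β.
  ▷K-lifts : ∀ s t β → ▷K s ⊑K β → β ⊑K ▷K t → neg (s ∧ (neg (e 𝔸 β) ∨ t)) ≡ e 𝔸 β
  ▷K-lifts s t β s′≤β β≤t′ =
    trans (neg-∧ s y) (trans (cong (λ z → neg (neg (neg s ∨ z))) y′≡b)
      (trans (cong (λ z → neg (neg z)) (⊑⇒∨≡ s′≤b)) (kernel-fixed β)))
    where
      b y : L
      b = e 𝔸 β
      y = neg b ∨ t
      s′≤b : neg s ⊑ b
      s′≤b = subst (_⊑ b) (e-▷K s) (⊑K⇒⊑ {▷K s} {β} s′≤β)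
      b≤t′ : b ⊑ neg t
      b≤t′ = subst (b ⊑_) (e-▷K t) (⊑K⇒⊑ {β} {▷K t} β≤t′)
      -- y′ = b″ ∧ t′ = b ∧ t′ = b
      y′≡b : neg y ≡ b
      y′≡b = trans (neg-∨ (neg b) t) (trans (cong (_∧ neg t) (kernel-fixed β)) b≤t′)

  ▷K-isLiftingHomomorphism : IsLiftingHomomorphism (dualLattice (latL 𝔸)) (latK 𝔸) ▷K
  ▷K-isLiftingHomomorphism = record
    { monotone = λ x y y≤x → ⊑⇒⊑K {▷K x} {▷K y}
        (subst₂ _⊑_ (sym (e-▷K x)) (sym (e-▷K y)) (neg-antitone y≤x))
    ; preserves-⊓ = λ x y → ≡⇒⊑K {_∩_ 𝔸 (▷K x) (▷K y)} {▷K (x ∨ y)}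
        (trans (cong (λ z → neg (neg z)) (trans (cong₂ _∧_ (e-▷K x) (e-▷K y)) (sym (neg-∨ x y))))
               (trans (sym (neg³ (x ∨ y))) (sym (e-▷K (x ∨ y)))))
    ; preserves-⊔ = λ x y → ≡⇒⊑K {▷K (x ∧ y)} {_∪_ 𝔸 (▷K x) (▷K y)}
        (trans (e-▷K (x ∧ y)) (trans (neg-∧ x y)
          (sym (trans (neg⁴≡neg² _) (cong (λ z → neg (neg z)) (cong₂ _∨_ (e-▷K x) (e-▷K y)))))))
    ; preserves-top = ≡⇒⊑K {1K 𝔸} {▷K ⊥} (trans (cong neg neg-⊤) (trans neg-⊥ (sym (trans (e-▷K ⊥) neg-⊥))))
    ; preserves-bot = ≡⇒⊑K {▷K ⊤} {0K 𝔸} (trans (e-▷K ⊤) (trans neg-⊤ (sym (trans (cong neg neg-⊥) neg-⊤))))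
    ; lifts-interval = λ s t β s′≤β β≤t′ →
        s ∧ (neg (e 𝔸 β) ∨ t) , ⊑-trans (∧-lb₁ s _) (∨-ub₁ s t) ,
        ∧-glb (∧-lb₁ s t) (⊑-trans (∧-lb₂ s t) (∨-ub₂ (neg (e 𝔸 β)) t)) ,
        ≡⇒⊑K {▷K (s ∧ (neg (e 𝔸 β) ∨ t))} {β} (trans (e-▷K _) (▷K-lifts s t β s′≤β β≤t′)) ,
        ≡⇒⊑K {β} {▷K (s ∧ (neg (e 𝔸 β) ∨ t))} (sym (trans (e-▷K _) (▷K-lifts s t β s′≤β β≤t′)))
    }

  e-resp : ∀ α β → α ⊑K β → β ⊑K α → e 𝔸 α ≡ e 𝔸 β
  e-resp α β = ⊑K-antisym {α} {β}

  star-resp : ∀ α β → α ⊑K β → β ⊑K α → star 𝔸 α ≡ star 𝔸 β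
  star-resp α β α≤β β≤α = cong (λ z → h 𝔸 (neg z)) (⊑K-antisym {α} {β} α≤β β≤α)

lemma3p16 : ∀ {a c ℓ : Level} (𝔸 : SemiDeMorgan a)
    (Lδ : CompleteLattice c ℓ (lsuc a ⊔ ℓ)) (eL : SemiDeMorgan.L 𝔸 → CompleteLattice.Carrier Lδ)
    (Kδ : CompleteLattice c ℓ (lsuc a ⊔ ℓ)) (eK : K 𝔸 → CompleteLattice.Carrier Kδ) →
    IsCanonicalExtension (latL 𝔸) Lδ eL →
    IsCanonicalExtension (latK 𝔸) Kδ eK →
    (∀ u → CompleteLattice._≈_ Lδ
             (πext (latL 𝔸) Lδ eL (latL 𝔸) Lδ eL (□ 𝔸) u)
             (πext (latK 𝔸) Kδ eK (latL 𝔸) Lδ eL (e 𝔸)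
               (πext (latL 𝔸) Lδ eL (latK 𝔸) Kδ eK (h 𝔸) u)))
    ×
    (∀ u → CompleteLattice._≈_ Lδ
             (πext (latL 𝔸) Lδ eL (latL 𝔸) Lδ eL (▷ 𝔸) u)
             (πext (latK 𝔸) Kδ eK (latL 𝔸) Lδ eL (e 𝔸)
               (πext (latK 𝔸) Kδ eK (latK 𝔸) Kδ eK (star 𝔸)
                 (πext (latL 𝔸) Lδ eL (latK 𝔸) Kδ eK (h 𝔸) u))))
lemma3p16 𝔸 Lδ eL Kδ eK ceL ceK = □-via-kernel , ▷-via-kernel
  where
    open KernelMaps 𝔸
    module Lδ = CompleteLattice Lδ
    module Kδ = CompleteLattice Kδ
    module Viaₕ = Composition (latL 𝔸) Lδ eL ceL (latK 𝔸) Kδ eK ceK (h 𝔸) h-isLiftingHomomorphism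
    module Via▷ = Composition (dualLattice (latL 𝔸)) (dualComplete Lδ) eL (dualCanonical ceL)
                              (latK 𝔸) Kδ eK ceK ▷K ▷K-isLiftingHomomorphism
    module PKL = PiExtension (latK 𝔸) Kδ eK (latL 𝔸) Lδ eL

    module PLL = PiExtension (latL 𝔸) Lδ eL (latL 𝔸) Lδ eL
    module PLK = PiExtension (latL 𝔸) Lδ eL (latK 𝔸) Kδ eK
    module PKK = PiExtension (latK 𝔸) Kδ eK (latK 𝔸) Kδ eK

    -- □ = e ∘ h
    □-via-kernel : ∀ u → PLL.π (□ 𝔸) u Lδ.≈ PKL.π (e 𝔸) (PLK.π (h 𝔸) u)
    □-via-kernel = Viaₕ.π-∘ (latL 𝔸) Lδ eL (e 𝔸) e-resp

    -- ▷ = e ∘ ▷K on L^∂, and ▷K = * ∘ h on L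
    ▷-via-kernel : ∀ u → PLL.π (▷ 𝔸) u Lδ.≈ PKL.π (e 𝔸) (PKK.π (star 𝔸) (PLK.π (h 𝔸) u))
    ▷-via-kernel u = Lδ.Eq.trans
      (PLL.π-pointwise (▷ 𝔸) (λ x → e 𝔸 (▷K x)) (λ x → sym (e-▷K x)) u)
      (Lδ.Eq.trans (π-dual-domain (latL 𝔸) Lδ eL (latL 𝔸) Lδ eL (λ x → e 𝔸 (▷K x)) u)
      (Lδ.Eq.trans (Via▷.π-∘ (latL 𝔸) Lδ eL (e 𝔸) e-resp u)
      (Lδ.Eq.trans (PKL.π-cong (e 𝔸) (Kδ.Eq.sym (π-dual-domain (latL 𝔸) Lδ eL (latK 𝔸) Kδ eK ▷K u)))
                   (PKL.π-cong (e 𝔸) (Viaₕ.π-∘ (latK 𝔸) Kδ eK (star 𝔸) star-resp u)))))
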